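{- For every fixed prime power $q\ge 5$ there is a constant $C_q$ such that $\chi_q(n) \le n/2 + C_q$ for all integers $n\ge 1$; and for $q\in\{3,4\}$ there is a constant $C_q$ such that $\chi_q(n)\le 3n/5 + C_q$ for all integers $n\ge1$.
   Context: For a prime power $q$ and integer $n\ge 1$, $\mathrm{PG}(n-1,q)$ is the projective space whose points are the $1$-dimensional subspaces of $\mathbb{F}_q^n$ and whose lines are the sets of points contained in $2$-dimensional subspaces. $\chi_q(n)$ denotes the minimum number of colors needed to color the points of $\mathrm{PG}(n-1,q)$ so that no line is monochromatic. -}

module Defs where

open import Level using (0ℓ)
open import Algebra.Bundles using (CommutativeRing)
open import Data.Nat using (ℕ; suc; _^_)
open import Data.Nat.Primality using (Prime)
open import Data.Fin using (Fin)
open import Data.Product using (Σ; ∃; _×_; _,_)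
open import Relation.Nullary using (¬_)
open import Relation.Binary.PropositionalEquality using (_≡_)

IsPrimePower : ℕ → Set
IsPrimePower q = Σ ℕ λ p → Σ ℕ λ k → Prime p × q ≡ p ^ suc k

IsField : CommutativeRing 0ℓ 0ℓ → Set
IsField R = ¬ (1# ≈ 0#) × (∀ x → ¬ (x ≈ 0#) → ∃ λ y → (x * y) ≈ 1#)
  where open CommutativeRing R

HasCard : CommutativeRing 0ℓ 0ℓ → ℕ → Set
HasCard R q = Σ (Fin q → Carrier) λ e →
    (∀ i j → e i ≈ e j → i ≡ j) × (∀ x → ∃ λ i → e i ≈ x)
  where open CommutativeRing R

module Proj (R : CommutativeRing 0ℓ 0ℓ) (n : ℕ) where
  open CommutativeRing R

  V : Set
  V = Fin n → Carrier

  _≈ᵥ_ : V → V → Set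
  u ≈ᵥ v = ∀ i → u i ≈ v i

  𝟎 : V
  𝟎 i = 0#

  NonZero : V → Set
  NonZero v = ¬ (v ≈ᵥ 𝟎)

  lin : Carrier → V → Carrier → V → V
  lin a u b v i = (a * u i) + (b * v i)

  LinIndep : V → V → Set
  LinIndep u v = ∀ a b → lin a u b v ≈ᵥ 𝟎 → (a ≈ 0#) × (b ≈ 0#)

  -- A coloring of the points of PG(n-1,F) with k colors: a map on
  -- nonzero vectors that is constant on each 1-dimensional subspace
  -- (i.e. invariant under nonzero scalar multiples).
  record Coloring (k : ℕ) : Set where
    field
      col : (v : V) → NonZero v → Fin k
      wd  : ∀ u v (nu : NonZero u) (nv : NonZero v) λ' →
            ¬ (λ' ≈ 0#) → (∀ i → u i ≈ (λ' * v i)) → col u nu ≡ col v nv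

  Monochromatic : ∀ {k} → Coloring k → (u v : V) → NonZero u → Set
  Monochromatic c u v nu = ∀ a b (nw : NonZero (lin a u b v)) →
    Coloring.col c (lin a u b v) nw ≡ Coloring.col c u nu

  Proper : ∀ {k} → Coloring k → Set
  Proper c = ∀ u v (nu : NonZero u) → LinIndep u v → ¬ Monochromatic c u v nu

  -- χ_F(n) ≤ m : the points of PG(n-1,F) can be properly colored with m colors
  χ≤ : ℕ → Set
  χ≤ m = Σ (Coloring m) Proper

{-# OPTIONS --safe #-}
-- Both bounds follow from χ_q(n) ≤ ⌊n/2⌋ + 2, valid over every finite field with at least three
-- elements.  Fix ω ∉ {0, 1} and read a
-- vector in consecutive coordinate pairs (x, y).  Skipping pairs (0, 0), the colour is the position
-- of the first pair with y ≠ 0, unless a pair (x ≠ 0, 0) comes first; from then on it is the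
-- position of the first pair off both lines y = x and y = ωx.  Two more colours serve vectors that
-- end before such a pair occurs.
--
-- For a line ⟨u, v⟩ look at the rank of its leading 2 × 2 block.  Rank two yields points with
-- leading pairs (0, Δ) and (Δ′, 0), which get different colours; rank zero reduces to the tails.
-- In rank one the line contains z with leading pair (0, 0), coloured like its tail, and p with a
-- nonzero leading pair.  The interesting case is p = (x ≠ 0, 0, …): then all p + t z start with
-- (x, 0), and some t separates the colour of p + t z from that of z: on an affine line p + t D,
-- the pair at the position of the first nonzero pair of D can be moved onto one of the lines
-- y = x, y = ωx, or off both, as needed.
module Submission where

open import Defs
open import Level using (0ℓ)
open import Algebra.Bundles using (CommutativeRing)
open import Data.Bool using (true; false; if_then_else_)
open import Data.Fin using (Fin; zero; suc; toℕ; fromℕ<)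
import Data.Fin as Fin
open import Data.Fin.Properties using (toℕ-fromℕ<; fromℕ<-cong)
open import Data.Nat using (ℕ; zero; suc; _≤_; _<_; _≥_; s≤s; z<s; s<s)
open import Data.Nat.Properties using (≤-refl; ≤-trans; n≤1+n; m≤m+n; m<n⇒m<1+n; n<1+n; <⇒≢)
open import Data.Product using (Σ; ∃-syntax; ∃₂; _×_; _,_; proj₁; proj₂; map₂)
open import Data.Sum using (_⊎_; inj₁; inj₂; [_,_])
open import Data.Sum.Function.Propositional using (_⊎-⇔_)
open import Data.Vec.Functional using (_∷_)
open import Function using (_∘_; _⇔_; mk⇔; Equivalence)
open import Relation.Binary.Bundles using (Setoid)
open import Relation.Binary.Definitions using (Decidable)
open import Relation.Binary.PropositionalEquality using (_≡_; _≢_; cong; module ≡-Reasoning)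
import Relation.Binary.PropositionalEquality as ≡
open import Data.Empty using (⊥; ⊥-elim)
open import Relation.Nullary using (¬_; Dec; yes; no; does)
open import Relation.Nullary.Decidable using (dec-true; dec-false; does-⇔; map′; _⊎-dec_)

private variable
  n q : ℕ

module Palette where
  open import Data.Nat using (_+_; _*_; ⌊_/2⌋; ⌈_/2⌉)
  open import Data.Nat.Properties

  palette : ℕ → ℕ
  palette n = 2 + ⌊ n /2⌋

  2*⌊n/2⌋≤n : ∀ n → 2 * ⌊ n /2⌋ ≤ n
  2*⌊n/2⌋≤n n = begin
    ⌊ n /2⌋ + (⌊ n /2⌋ + 0)  ≡⟨ cong (⌊ n /2⌋ +_) (+-identityʳ ⌊ n /2⌋) ⟩
    ⌊ n /2⌋ + ⌊ n /2⌋        ≤⟨ +-monoʳ-≤ ⌊ n /2⌋ (⌊n/2⌋≤⌈n/2⌉ n) ⟩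
    ⌊ n /2⌋ + ⌈ n /2⌉        ≡⟨ ⌊n/2⌋+⌈n/2⌉≡n n ⟩
    n                        ∎
    where open ≤-Reasoning

  2*palette≤n+4 : ∀ n → 2 * palette n ≤ n + 4
  2*palette≤n+4 n = begin
    2 * (2 + ⌊ n /2⌋)  ≡⟨ *-distribˡ-+ 2 2 ⌊ n /2⌋ ⟩
    4 + 2 * ⌊ n /2⌋    ≤⟨ +-monoʳ-≤ 4 (2*⌊n/2⌋≤n n) ⟩
    4 + n              ≡⟨ +-comm 4 n ⟩
    n + 4              ∎
    where open ≤-Reasoning

  5*palette≤3n+10 : ∀ n → 5 * palette n ≤ 3 * n + 10
  5*palette≤3n+10 n = begin
    5 * (2 + ⌊ n /2⌋)       ≡⟨ *-distribˡ-+ 5 2 ⌊ n /2⌋ ⟩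
    10 + 5 * ⌊ n /2⌋        ≤⟨ +-monoʳ-≤ 10 (*-monoˡ-≤ ⌊ n /2⌋ (n≤1+n 5)) ⟩
    10 + 6 * ⌊ n /2⌋        ≡⟨ cong (10 +_) (*-assoc 3 2 ⌊ n /2⌋) ⟩
    10 + 3 * (2 * ⌊ n /2⌋)  ≤⟨ +-monoʳ-≤ 10 (*-monoʳ-≤ 3 (2*⌊n/2⌋≤n n)) ⟩
    10 + 3 * n              ≡⟨ +-comm 10 (3 * n) ⟩
    3 * n + 10              ∎
    where open ≤-Reasoning

open Palette using (palette; 2*palette≤n+4; 5*palette≤3n+10)

module _ {c ℓ} (S : Setoid c ℓ) (_≟_ : Decidable (Setoid._≈_ S)) where
  open Setoid S

  avoid-second : ∀ {a b x y} → x ≉ a → y ≉ a → x ≉ y → ∃[ w ] w ≉ a × w ≉ b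
  avoid-second {b = b} {x} {y} x≉a y≉a x≉y with x ≟ b
  ... | no x≉b = x , x≉a , x≉b
  ... | yes x≈b = y , y≉a , λ y≈b → x≉y (trans x≈b (sym y≈b))

  avoid-two : ∀ a b {x y z} → x ≉ y → x ≉ z → y ≉ z → ∃[ w ] w ≉ a × w ≉ b
  avoid-two a b {x} {y} {z} x≉y x≉z y≉z with x ≟ a | y ≟ a
  ... | yes x≈a | _ = avoid-second (x≉y ∘ trans x≈a ∘ sym) (x≉z ∘ trans x≈a ∘ sym) y≉z
  ... | no x≉a | yes y≈a = avoid-second x≉a (y≉z ∘ trans y≈a ∘ sym) x≉z
  ... | no x≉a | no y≉a = avoid-second x≉a y≉a x≉y

module FiniteRing (F : CommutativeRing 0ℓ 0ℓ) where
  open CommutativeRing F hiding (zero)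

  ≈-dec : HasCard F q → Decidable _≈_
  ≈-dec (e , e-inj , e-surj) x y with e-surj x | e-surj y
  ... | i , eᵢ≈x | j , eⱼ≈y =
    map′ (λ i≡j → trans (sym eᵢ≈x) (trans (reflexive (cong e i≡j)) eⱼ≈y))
         (λ x≈y → e-inj i j (trans eᵢ≈x (trans x≈y (sym eⱼ≈y))))
         (i Fin.≟ j)

  ∃≉0,1 : 3 ≤ q → HasCard F q → ∃[ ω ] ω ≉ 0# × ω ≉ 1#
  ∃≉0,1 (s≤s (s≤s (s≤s _))) card@(e , e-inj , _) =
    avoid-two setoid (≈-dec card) 0# 1#
      (distinct zero (suc zero) λ ()) (distinct zero (suc (suc zero)) λ ()) (distinct (suc zero) (suc (suc zero)) λ ())
    where
    distinct : ∀ i j → i ≢ j → e i ≉ e j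
    distinct i j i≢j = i≢j ∘ e-inj i j

module Field (F : CommutativeRing 0ℓ 0ℓ) (isField : IsField F) where
  open CommutativeRing F hiding (zero)
  open import Algebra.Properties.Ring ring
    using (-‿distribˡ-*; -‿injective; -0#≈0#; x∙y⁻¹≈ε⇒x≈y; x≈y⇒x∙y⁻¹≈ε; //-rightDividesˡ)
  open import Algebra.Properties.CommutativeSemigroup *-commutativeSemigroup using (x∙yz≈y∙xz)
  open import Algebra.Properties.CommutativeSemigroup +-commutativeSemigroup
    using () renaming (interchange to +-interchange)
  open import Algebra.Solver.Ring.NaturalCoefficients.Default commutativeSemiring
    using (solve; _:=_; _:+_; _:*_; con)
  open import Relation.Binary.Reasoning.Setoid setoid

  private variable
    l x x′ y y′ : Carrier

  1≉0 : 1# ≉ 0#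
  1≉0 = proj₁ isField

  *-cancelˡ-≉0 : ∀ {l x y} → l ≉ 0# → l * x ≈ l * y → x ≈ y
  *-cancelˡ-≉0 {l} {x} {y} l≉0 lx≈ly with proj₂ isField l l≉0
  ... | l⁻¹ , ll⁻¹≈1 = begin
    x              ≈⟨ *-identityˡ x ⟨
    1# * x         ≈⟨ *-congʳ ll⁻¹≈1 ⟨
    l * l⁻¹ * x    ≈⟨ solve 3 (λ l l⁻¹ x → l :* l⁻¹ :* x := l⁻¹ :* (l :* x)) refl l l⁻¹ x ⟩
    l⁻¹ * (l * x)  ≈⟨ *-congˡ lx≈ly ⟩
    l⁻¹ * (l * y)  ≈⟨ solve 3 (λ l l⁻¹ y → l⁻¹ :* (l :* y) := l :* l⁻¹ :* y) refl l l⁻¹ y ⟩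
    l * l⁻¹ * y    ≈⟨ *-congʳ ll⁻¹≈1 ⟩
    1# * y         ≈⟨ *-identityˡ y ⟩
    y              ∎

  scale-⇔ : l ≉ 0# → x ≈ l * x′ → y ≈ l * y′ → (x ≈ y) ⇔ (x′ ≈ y′)
  scale-⇔ l≉0 x≈lx′ y≈ly′ = mk⇔
    (λ x≈y → *-cancelˡ-≉0 l≉0 (trans (sym x≈lx′) (trans x≈y y≈ly′)))
    (λ x′≈y′ → trans x≈lx′ (trans (*-congˡ x′≈y′) (sym y≈ly′)))

  affine-root : ∀ {a} → a ≉ 0# → ∀ c x → ∃[ t ] c + t * a ≈ x
  affine-root {a} a≉0 c x with proj₂ isField a a≉0
  ... | a⁻¹ , aa⁻¹≈1 = (x - c) * a⁻¹ , (begin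
    c + (x - c) * a⁻¹ * a    ≈⟨ +-congˡ (solve 3 (λ d a a⁻¹ → d :* a⁻¹ :* a := d :* (a :* a⁻¹)) refl (x - c) a a⁻¹) ⟩
    c + (x - c) * (a * a⁻¹)  ≈⟨ +-congˡ (*-congˡ aa⁻¹≈1) ⟩
    c + (x - c) * 1#         ≈⟨ +-congˡ (*-identityʳ (x - c)) ⟩
    c + (x - c)              ≈⟨ +-comm c (x - c) ⟩
    x - c + c                ≈⟨ //-rightDividesˡ c x ⟩
    x                        ∎)

  -x≈0⇒x≈0 : - x ≈ 0# → x ≈ 0#
  -x≈0⇒x≈0 -x≈0 = -‿injective (trans -x≈0 (sym -0#≈0#))

  x-yz≈0⇔x≈yz : ∀ x y z → x + (- y) * z ≈ 0# ⇔ x ≈ y * z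
  x-yz≈0⇔x≈yz x y z = mk⇔
    (λ x-yz≈0 → x∙y⁻¹≈ε⇒x≈y x (y * z) (trans (+-congˡ (-‿distribˡ-* y z)) x-yz≈0))
    (λ x≈yz → trans (+-congˡ (sym (-‿distribˡ-* y z))) (x≈y⇒x∙y⁻¹≈ε x≈yz))

  line-meets-slope : ∀ μ a₀ b₀ {a b} → b ≉ μ * a → ∃[ t ] b₀ + t * b ≈ μ * (a₀ + t * a)
  line-meets-slope μ a₀ b₀ {a} {b} b≉μa = map₂ on-slope (affine-root d≉0 (b₀ + (- μ) * a₀) 0#)
    where
    d≉0 : b + (- μ) * a ≉ 0#
    d≉0 = b≉μa ∘ Equivalence.to (x-yz≈0⇔x≈yz b μ a)
    on-slope : ∀ {t} → b₀ + (- μ) * a₀ + t * (b + (- μ) * a) ≈ 0# → b₀ + t * b ≈ μ * (a₀ + t * a)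
    on-slope {t} root = Equivalence.to (x-yz≈0⇔x≈yz (b₀ + t * b) μ (a₀ + t * a)) (begin
      b₀ + t * b + (- μ) * (a₀ + t * a)            ≈⟨ +-congˡ (distribˡ (- μ) a₀ (t * a)) ⟩
      b₀ + t * b + ((- μ) * a₀ + (- μ) * (t * a))  ≈⟨ +-interchange b₀ (t * b) ((- μ) * a₀) ((- μ) * (t * a)) ⟩
      b₀ + (- μ) * a₀ + (t * b + (- μ) * (t * a))  ≈⟨ +-congˡ (+-congˡ (x∙yz≈y∙xz (- μ) t a)) ⟩
      b₀ + (- μ) * a₀ + (t * b + t * ((- μ) * a))  ≈⟨ +-congˡ (distribˡ t b ((- μ) * a)) ⟨
      b₀ + (- μ) * a₀ + t * (b + (- μ) * a)        ≈⟨ root ⟩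
      0#                                           ∎)

  Vector : ℕ → Set
  Vector n = Proj.V F n

  open module Vectors {n} = Proj F n public using (_≈ᵥ_; NonZero; lin; LinIndep)

  _∈⟨_,_⟩ : Vector n → Vector n → Vector n → Set
  w ∈⟨ u , v ⟩ = ∃₂ λ α β → w ≈ᵥ lin α u β v

  private variable
    u v w w₁ w₂ : Vector n

  1x+0y≈x : ∀ {x y} → 1# * x + 0# * y ≈ x
  1x+0y≈x {x} {y} = solve 2 (λ x y → con 1 :* x :+ con 0 :* y := x) refl x y

  1x+ty≈x : ∀ {t x y} → y ≈ 0# → 1# * x + t * y ≈ x
  1x+ty≈x {t} {x} {y} y≈0 = begin
    1# * x + t * y   ≈⟨ +-congˡ (*-congˡ y≈0) ⟩
    1# * x + t * 0#  ≈⟨ solve 2 (λ x t → con 1 :* x :+ t :* con 0 := x) refl x t ⟩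
    x                ∎

  ax+by≈0 : ∀ a b {x y} → x ≈ 0# → y ≈ 0# → a * x + b * y ≈ 0#
  ax+by≈0 a b {x} {y} x≈0 y≈0 = begin
    a * x + b * y    ≈⟨ +-cong (*-congˡ x≈0) (*-congˡ y≈0) ⟩
    a * 0# + b * 0#  ≈⟨ solve 2 (λ a b → a :* con 0 :+ b :* con 0 := con 0) refl a b ⟩
    0#               ∎

  ∈⟨⟩-lin : ∀ α β → lin α u β v ∈⟨ u , v ⟩
  ∈⟨⟩-lin α β = α , β , λ _ → refl

  ∈⟨⟩-left : u ∈⟨ u , v ⟩
  ∈⟨⟩-left = 1# , 0# , λ _ → sym 1x+0y≈x

  ∈⟨⟩-right : v ∈⟨ u , v ⟩
  ∈⟨⟩-right {v = v} {u = u} = 0# , 1# , λ i →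
    solve 2 (λ x y → y := con 0 :* x :+ con 1 :* y) refl (u i) (v i)

  ∈⟨⟩-lin-closed : w₁ ∈⟨ u , v ⟩ → w₂ ∈⟨ u , v ⟩ → ∀ s t → lin s w₁ t w₂ ∈⟨ u , v ⟩
  ∈⟨⟩-lin-closed {w₁ = w₁} {u = u} {v} {w₂} (α₁ , β₁ , w₁≈) (α₂ , β₂ , w₂≈) s t =
    s * α₁ + t * α₂ , s * β₁ + t * β₂ , λ i → begin
      s * w₁ i + t * w₂ i
        ≈⟨ +-cong (*-congˡ (w₁≈ i)) (*-congˡ (w₂≈ i)) ⟩
      s * (α₁ * u i + β₁ * v i) + t * (α₂ * u i + β₂ * v i)
        ≈⟨ solve 8 (λ s t α₁ β₁ α₂ β₂ x y →
             s :* (α₁ :* x :+ β₁ :* y) :+ t :* (α₂ :* x :+ β₂ :* y)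
             := (s :* α₁ :+ t :* α₂) :* x :+ (s :* β₁ :+ t :* β₂) :* y)
           refl s t α₁ β₁ α₂ β₂ (u i) (v i) ⟩
      (s * α₁ + t * α₂) * u i + (s * β₁ + t * β₂) * v i  ∎

  indep⇒nonzero : LinIndep u v → NonZero u
  indep⇒nonzero indep u≈0 = 1≉0 (proj₁ (indep 1# 0# λ i → trans 1x+0y≈x (u≈0 i)))

  eliminate : Vector n → Vector n → Fin n → Vector n
  eliminate u v i = lin (v i) u (- u i) v

  eliminate≈0⇔ : ∀ (u v : Vector n) i j → eliminate u v i j ≈ 0# ⇔ v i * u j ≈ u i * v j
  eliminate≈0⇔ u v i j = x-yz≈0⇔x≈yz (v i * u j) (u i) (v j)

  eliminate-vanishes : ∀ (u v : Vector n) i → eliminate u v i i ≈ 0#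
  eliminate-vanishes u v i = Equivalence.from (eliminate≈0⇔ u v i i) (*-comm (v i) (u i))

  eliminate-swap : ∀ (u v : Vector n) i j → eliminate u v i j ≈ 0# → eliminate u v j i ≈ 0#
  eliminate-swap u v i j eᵢⱼ≈0 = Equivalence.from (eliminate≈0⇔ u v j i) (begin
    v j * u i  ≈⟨ *-comm (v j) (u i) ⟩
    u i * v j  ≈⟨ Equivalence.to (eliminate≈0⇔ u v i j) eᵢⱼ≈0 ⟨
    v i * u j  ≈⟨ *-comm (v i) (u j) ⟩
    u j * v i  ∎)

  eliminate-nonzero : ∀ {i} → LinIndep u v → u i ≉ 0# → NonZero (eliminate u v i)
  eliminate-nonzero indep uᵢ≉0 e≈0 = uᵢ≉0 (-x≈0⇒x≈0 (proj₂ (indep _ _ e≈0)))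

  tail₂ : Vector (suc (suc n)) → Vector n
  tail₂ u i = u (suc (suc i))

  pad₂ : Vector n → Vector (suc (suc n))
  pad₂ w = 0# ∷ 0# ∷ w

  LeadingZero : Vector (suc (suc n)) → Set
  LeadingZero u = u zero ≈ 0# × u (suc zero) ≈ 0#

  tail₂-nonzero : LeadingZero w → NonZero w → NonZero (tail₂ w)
  tail₂-nonzero (w₀≈0 , w₁≈0) w≢0 tail≈0 = w≢0 λ where
    zero → w₀≈0
    (suc zero) → w₁≈0
    (suc (suc i)) → tail≈0 i

  pad₂-nonzero : NonZero w → NonZero (pad₂ w)
  pad₂-nonzero w≢0 pad≈0 = w≢0 (λ i → pad≈0 (suc (suc i)))

  tail₂-indep : LeadingZero u → LeadingZero v → LinIndep u v → LinIndep (tail₂ u) (tail₂ v)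
  tail₂-indep (u₀≈0 , u₁≈0) (v₀≈0 , v₁≈0) indep α β tail≈0 = indep α β λ where
    zero → ax+by≈0 α β u₀≈0 v₀≈0
    (suc zero) → ax+by≈0 α β u₁≈0 v₁≈0
    (suc (suc i)) → tail≈0 i

  pad₂-∈⟨⟩ : LeadingZero u → LeadingZero v → w ∈⟨ tail₂ u , tail₂ v ⟩ → pad₂ w ∈⟨ u , v ⟩
  pad₂-∈⟨⟩ (u₀≈0 , u₁≈0) (v₀≈0 , v₁≈0) (α , β , w≈) = α , β , λ where
    zero → sym (ax+by≈0 α β u₀≈0 v₀≈0)
    (suc zero) → sym (ax+by≈0 α β u₁≈0 v₁≈0)
    (suc (suc i)) → w≈ i

module Colouring (F : CommutativeRing 0ℓ 0ℓ) (isField : IsField F)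
                 (_≟_ : Decidable (CommutativeRing._≈_ F))
                 (ω : CommutativeRing.Carrier F)
                 (ω≉0 : ¬ CommutativeRing._≈_ F ω (CommutativeRing.0# F))
                 (ω≉1 : ¬ CommutativeRing._≈_ F ω (CommutativeRing.1# F)) where
  open CommutativeRing F hiding (zero)
  open Field F isField
  open import Algebra.Properties.CommutativeSemigroup *-commutativeSemigroup using (x∙yz≈y∙xz)

  private variable
    x x′ y y′ : Carrier
    u v : Vector n
    K : ℕ

  data PairShape (x y : Carrier) : Set where
    pair-00 : x ≈ 0# → y ≈ 0# → PairShape x y
    pair-x0 : x ≉ 0# → y ≈ 0# → PairShape x y
    pair-xy : y ≉ 0# → PairShape x y

  pairShape : ∀ x y → PairShape x y
  pairShape x y with x ≟ 0# | y ≟ 0#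
  ... | yes x≈0 | yes y≈0 = pair-00 x≈0 y≈0
  ... | no x≉0 | yes y≈0 = pair-x0 x≉0 y≈0
  ... | _ | no y≉0 = pair-xy y≉0

  OnDiagonals : Carrier → Carrier → Set
  OnDiagonals x y = y ≈ x ⊎ y ≈ ω * x

  onDiagonals? : ∀ x y → Dec (OnDiagonals x y)
  onDiagonals? x y = (y ≟ x) ⊎-dec (y ≟ (ω * x))

  -- palette m, for m the number of coordinates after the current pair, records its position.
  -- The end colours of colour′ and colour differ for odd length, as escape needs.
  colour′ : Vector n → ℕ
  colour′ {zero} _ = 0
  colour′ {suc zero} _ = 1
  colour′ {suc (suc n)} u =
    if does (onDiagonals? (u zero) (u (suc zero))) then colour′ (tail₂ u) else palette n

  colour : Vector n → ℕ
  colour {zero} _ = 0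
  colour {suc zero} _ = 0
  colour {suc (suc n)} u =
    if does (u (suc zero) ≟ 0#)
    then (if does (u zero ≟ 0#) then colour (tail₂ u) else colour′ (tail₂ u))
    else palette n

  colour′<palette : (u : Vector n) → colour′ u < palette n
  colour′<palette {zero} _ = z<s
  colour′<palette {suc zero} _ = s<s z<s
  colour′<palette {suc (suc n)} u with does (onDiagonals? (u zero) (u (suc zero)))
  ... | true = m<n⇒m<1+n (colour′<palette (tail₂ u))
  ... | false = n<1+n (palette n)

  colour<palette : (u : Vector n) → colour u < palette n
  colour<palette {zero} _ = z<s
  colour<palette {suc zero} _ = z<s
  colour<palette {suc (suc n)} u with does (u (suc zero) ≟ 0#) | does (u zero ≟ 0#)
  ... | true | true = m<n⇒m<1+n (colour<palette (tail₂ u))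
  ... | true | false = m<n⇒m<1+n (colour′<palette (tail₂ u))
  ... | false | _ = n<1+n (palette n)

  colour′≢palette : (u : Vector n) → colour′ u ≢ palette n
  colour′≢palette u = <⇒≢ (colour′<palette u)

  colour≢palette : (u : Vector n) → colour u ≢ palette n
  colour≢palette u = <⇒≢ (colour<palette u)

  colour′-diagonal : (u : Vector (suc (suc n))) → OnDiagonals (u zero) (u (suc zero)) →
                     colour′ u ≡ colour′ (tail₂ u)
  colour′-diagonal u on rewrite dec-true (onDiagonals? (u zero) (u (suc zero))) on = ≡.refl

  colour′-offDiagonal : (u : Vector (suc (suc n))) → ¬ OnDiagonals (u zero) (u (suc zero)) →
                        colour′ u ≡ palette n
  colour′-offDiagonal u off rewrite dec-false (onDiagonals? (u zero) (u (suc zero))) off = ≡.refl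

  colour-00 : (u : Vector (suc (suc n))) → LeadingZero u → colour u ≡ colour (tail₂ u)
  colour-00 u (u₀≈0 , u₁≈0)
    rewrite dec-true (u (suc zero) ≟ 0#) u₁≈0 | dec-true (u zero ≟ 0#) u₀≈0 = ≡.refl

  colour-x0 : (u : Vector (suc (suc n))) → u zero ≉ 0# → u (suc zero) ≈ 0# →
              colour u ≡ colour′ (tail₂ u)
  colour-x0 u u₀≉0 u₁≈0
    rewrite dec-true (u (suc zero) ≟ 0#) u₁≈0 | dec-false (u zero ≟ 0#) u₀≉0 = ≡.refl

  colour-xy : (u : Vector (suc (suc n))) → u (suc zero) ≉ 0# → colour u ≡ palette n
  colour-xy u u₁≉0 rewrite dec-false (u (suc zero) ≟ 0#) u₁≉0 = ≡.refl

  onDiagonals-scale : ∀ {l x x′ y y′} → l ≉ 0# → x ≈ l * x′ → y ≈ l * y′ →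
                      OnDiagonals x y ⇔ OnDiagonals x′ y′
  onDiagonals-scale {l} {x} {x′} l≉0 x≈lx′ y≈ly′ =
    scale-⇔ l≉0 y≈ly′ x≈lx′ ⊎-⇔ scale-⇔ l≉0 y≈ly′ (trans (*-congˡ x≈lx′) (x∙yz≈y∙xz ω l x′))

  colour′-scale : ∀ {n l} {u v : Vector n} → l ≉ 0# → (∀ i → u i ≈ l * v i) → colour′ u ≡ colour′ v
  colour′-scale {zero} _ _ = ≡.refl
  colour′-scale {suc zero} _ _ = ≡.refl
  colour′-scale {suc (suc n)} {u = u} {v} l≉0 u≈lv
    rewrite does-⇔ (onDiagonals-scale l≉0 (u≈lv zero) (u≈lv (suc zero)))
                   (onDiagonals? (u zero) (u (suc zero))) (onDiagonals? (v zero) (v (suc zero)))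
    with does (onDiagonals? (v zero) (v (suc zero)))
  ... | true = colour′-scale l≉0 (λ i → u≈lv (suc (suc i)))
  ... | false = ≡.refl

  colour-scale : ∀ {n l} {u v : Vector n} → l ≉ 0# → (∀ i → u i ≈ l * v i) → colour u ≡ colour v
  colour-scale {zero} _ _ = ≡.refl
  colour-scale {suc zero} _ _ = ≡.refl
  colour-scale {suc (suc n)} {l} {u} {v} l≉0 u≈lv
    rewrite does-⇔ (scale-⇔ l≉0 (u≈lv (suc zero)) (sym (zeroʳ l))) (u (suc zero) ≟ 0#) (v (suc zero) ≟ 0#)
          | does-⇔ (scale-⇔ l≉0 (u≈lv zero) (sym (zeroʳ l))) (u zero ≟ 0#) (v zero ≟ 0#)
    with does (v (suc zero) ≟ 0#) | does (v zero ≟ 0#)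
  ... | true | true = colour-scale l≉0 (λ i → u≈lv (suc (suc i)))
  ... | true | false = colour′-scale l≉0 (λ i → u≈lv (suc (suc i)))
  ... | false | _ = ≡.refl

  colour-cong : u ≈ᵥ v → colour u ≡ colour v
  colour-cong u≈v = colour-scale 1≉0 (λ i → trans (u≈v i) (sym (*-identityˡ _)))

  onDiagonals-resp : x ≈ x′ → y ≈ y′ → OnDiagonals x y → OnDiagonals x′ y′
  onDiagonals-resp x≈x′ y≈y′ (inj₁ y≈x) = inj₁ (trans (sym y≈y′) (trans y≈x x≈x′))
  onDiagonals-resp x≈x′ y≈y′ (inj₂ y≈ωx) = inj₂ (trans (sym y≈y′) (trans y≈ωx (*-congˡ x≈x′)))

  off-diagonals : ∀ y → ∃[ x ] ¬ OnDiagonals x y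
  off-diagonals y with y ≟ 0#
  ... | yes y≈0 = 1# , [ (λ y≈1 → 1≉0 (trans (sym y≈1) y≈0))
                       , (λ y≈ω1 → ω≉0 (trans (sym (*-identityʳ ω)) (trans (sym y≈ω1) y≈0))) ]
  ... | no y≉0 = 0# , [ y≉0 , (λ y≈ω0 → y≉0 (trans y≈ω0 (zeroʳ ω))) ]

  -- The direction (a, b) is parallel to at most one of the lines y = x, y = ωx, as ω ≠ 1.
  diagonal-hit : ∀ a₀ b₀ {a b} → b ≉ 0# → ∃[ t ] OnDiagonals (a₀ + t * a) (b₀ + t * b)
  diagonal-hit a₀ b₀ {a} {b} b≉0 with b ≟ a
  ... | no b≉a = map₂ (λ hit → inj₁ (trans hit (*-identityˡ _)))
                      (line-meets-slope 1# a₀ b₀ (b≉a ∘ λ b≈1a → trans b≈1a (*-identityˡ a)))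
  ... | yes b≈a = map₂ inj₂ (line-meets-slope ω a₀ b₀ b≉ωa)
    where
    b≉ωa : b ≉ ω * a
    b≉ωa b≈ωa = ω≉1 (*-cancelˡ-≉0 (b≉0 ∘ trans b≈a) (begin
      a * ω   ≈⟨ *-comm a ω ⟩
      ω * a   ≈⟨ b≈ωa ⟨
      b       ≈⟨ b≈a ⟩
      a       ≈⟨ *-identityʳ a ⟨
      a * 1#  ∎))
      where open import Relation.Binary.Reasoning.Setoid setoid

  -- What defeats a line whose leading block has rank one.
  Escape : Vector n → Vector n → Set
  Escape p D = ∃[ t ] colour′ (lin 1# p t D) ≢ colour D

  escape-00 : (p D : Vector (suc (suc n))) → LeadingZero D → Escape (tail₂ p) (tail₂ D) → Escape p D
  escape-00 {n} p D D00 (t , differs) = t , escapes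
    where
    w : Vector (suc (suc n))
    w = lin 1# p t D
    escapes : colour′ w ≢ colour D
    escapes eq with onDiagonals? (w zero) (w (suc zero))
    ... | yes on = differs (≡.trans (≡.sym (colour′-diagonal w on)) (≡.trans eq (colour-00 D D00)))
    ... | no off = colour≢palette (tail₂ D)
                     (≡.trans (≡.sym (colour-00 D D00)) (≡.trans (≡.sym eq) (colour′-offDiagonal w off)))

  escape-x0 : (p D : Vector (suc (suc n))) → D zero ≉ 0# → D (suc zero) ≈ 0# → Escape p D
  escape-x0 {n} p D D₀≉0 D₁≈0 with off-diagonals (p (suc zero))
  ... | x , off with affine-root D₀≉0 (1# * p zero) x
  ...   | t , w₀≈x = t , λ eq → colour′≢palette (tail₂ D) (begin
          colour′ (tail₂ D)  ≡⟨ colour-x0 D D₀≉0 D₁≈0 ⟨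
          colour D           ≡⟨ eq ⟨
          colour′ w          ≡⟨ colour′-offDiagonal w (off ∘ onDiagonals-resp w₀≈x (1x+ty≈x D₁≈0)) ⟩
          palette n          ∎)
    where
    open ≡-Reasoning
    w : Vector (suc (suc n))
    w = lin 1# p t D

  escape-xy : (p D : Vector (suc (suc n))) → D (suc zero) ≉ 0# → Escape p D
  escape-xy {n} p D D₁≉0 with diagonal-hit (1# * p zero) (1# * p (suc zero)) D₁≉0
  ... | t , on = t , λ eq → colour′≢palette (tail₂ w) (begin
        colour′ (tail₂ w)  ≡⟨ colour′-diagonal w on ⟨
        colour′ w          ≡⟨ eq ⟩
        colour D           ≡⟨ colour-xy D D₁≉0 ⟩
        palette n          ∎)
    where
    open ≡-Reasoning
    w : Vector (suc (suc n))
    w = lin 1# p t D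

  escape : (p D : Vector n) → NonZero D → Escape p D
  escape {zero} p D D≢0 = ⊥-elim (D≢0 λ ())
  escape {suc zero} p D D≢0 = 0# , λ ()
  escape {suc (suc n)} p D D≢0 with pairShape (D zero) (D (suc zero))
  ... | pair-00 D₀≈0 D₁≈0 =
    escape-00 p D (D₀≈0 , D₁≈0) (escape (tail₂ p) (tail₂ D) (tail₂-nonzero (D₀≈0 , D₁≈0) D≢0))
  ... | pair-x0 D₀≉0 D₁≈0 = escape-x0 p D D₀≉0 D₁≈0
  ... | pair-xy D₁≉0 = escape-xy p D D₁≉0

  Monochrome : Vector n → Vector n → ℕ → Set
  Monochrome u v K = ∀ w → w ∈⟨ u , v ⟩ → NonZero w → colour w ≡ K

  monochrome-tail₂ : LeadingZero u → LeadingZero v → Monochrome u v K →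
                     Monochrome (tail₂ u) (tail₂ v) K
  monochrome-tail₂ u00 v00 mono w w∈ w≢0 =
    ≡.trans (≡.sym (colour-00 (pad₂ w) (refl , refl)))
            (mono (pad₂ w) (pad₂-∈⟨⟩ u00 v00 w∈) (pad₂-nonzero w≢0))

  rank-one : ∀ {n K} {u v : Vector (suc (suc n))} → Monochrome u v K → (p z : Vector (suc (suc n))) →
             p ∈⟨ u , v ⟩ → ¬ LeadingZero p →
             z ∈⟨ u , v ⟩ → LeadingZero z → NonZero z → ⊥
  rank-one {n} {K} mono p z p∈ p≢00 z∈ z00 z≢0 with pairShape (p zero) (p (suc zero))
  ... | pair-00 p₀≈0 p₁≈0 = p≢00 (p₀≈0 , p₁≈0)
  ... | pair-xy p₁≉0 = colour≢palette (tail₂ z) (begin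
        colour (tail₂ z)  ≡⟨ colour-00 z z00 ⟨
        colour z          ≡⟨ mono z z∈ z≢0 ⟩
        K                 ≡⟨ mono p p∈ (λ p≈0 → p₁≉0 (p≈0 (suc zero))) ⟨
        colour p          ≡⟨ colour-xy p p₁≉0 ⟩
        palette n         ∎)
    where open ≡-Reasoning
  ... | pair-x0 p₀≉0 p₁≈0 with escape (tail₂ p) (tail₂ z) (tail₂-nonzero z00 z≢0)
  ...   | t , differs = differs (begin
          colour′ (tail₂ w)  ≡⟨ colour-x0 w w₀≉0 w₁≈0 ⟨
          colour w           ≡⟨ mono w (∈⟨⟩-lin-closed p∈ z∈ 1# t) (λ w≈0 → w₀≉0 (w≈0 zero)) ⟩
          K                  ≡⟨ mono z z∈ z≢0 ⟨
          colour z           ≡⟨ colour-00 z z00 ⟩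
          colour (tail₂ z)   ∎)
    where
    open ≡-Reasoning
    w : Vector (suc (suc n))
    w = lin 1# p t z
    w₀≉0 : w zero ≉ 0#
    w₀≉0 w₀≈0 = p₀≉0 (trans (sym (1x+ty≈x (proj₁ z00))) w₀≈0)
    w₁≈0 : w (suc zero) ≈ 0#
    w₁≈0 = trans (1x+ty≈x (proj₂ z00)) p₁≈0

  -- eliminate u v zero (suc zero) is, up to sign, the determinant of the leading block.
  full-rank : ∀ {n K} (u v : Vector (suc (suc n))) → LinIndep u v →
              eliminate u v zero (suc zero) ≉ 0# → ¬ Monochrome u v K
  full-rank {n} {K} u v indep Δ≉0 mono = colour′≢palette (tail₂ w₁) (begin
    colour′ (tail₂ w₁)  ≡⟨ colour-x0 w₁ w₁₀≉0 (eliminate-vanishes u v (suc zero)) ⟨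
    colour w₁           ≡⟨ mono w₁ (∈⟨⟩-lin _ _) (λ w₁≈0 → w₁₀≉0 (w₁≈0 zero)) ⟩
    K                   ≡⟨ mono w₀ (∈⟨⟩-lin _ _) (λ w₀≈0 → Δ≉0 (w₀≈0 (suc zero))) ⟨
    colour w₀           ≡⟨ colour-xy w₀ Δ≉0 ⟩
    palette n           ∎)
    where
    open ≡-Reasoning
    w₀ w₁ : Vector (suc (suc n))
    w₀ = eliminate u v zero
    w₁ = eliminate u v (suc zero)
    w₁₀≉0 : w₁ zero ≉ 0#
    w₁₀≉0 = Δ≉0 ∘ eliminate-swap u v (suc zero) zero

  ¬monochrome : ∀ {n K} (u v : Vector n) → LinIndep u v → ¬ Monochrome u v K
  ¬monochrome {zero} u v indep _ = indep⇒nonzero indep λ ()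
  ¬monochrome {suc zero} u v indep _ = indep⇒nonzero indep λ where
    zero → -x≈0⇒x≈0 (proj₂ (indep _ _ λ { zero → eliminate-vanishes u v zero }))
  ¬monochrome {suc (suc n)} u v indep mono with eliminate u v zero (suc zero) ≟ 0#
  ... | no Δ≉0 = full-rank u v indep Δ≉0 mono
  ... | yes Δ≈0 with pairShape (u zero) (u (suc zero))
  ...   | pair-x0 u₀≉0 _ =
    rank-one mono u (eliminate u v zero) ∈⟨⟩-left (u₀≉0 ∘ proj₁)
      (∈⟨⟩-lin _ _) (eliminate-vanishes u v zero , Δ≈0) (eliminate-nonzero indep u₀≉0)
  ...   | pair-xy u₁≉0 =
    rank-one mono u (eliminate u v (suc zero)) ∈⟨⟩-left (u₁≉0 ∘ proj₂)
      (∈⟨⟩-lin _ _) (eliminate-swap u v zero (suc zero) Δ≈0 , eliminate-vanishes u v (suc zero))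
      (eliminate-nonzero indep u₁≉0)
  ...   | pair-00 u₀≈0 u₁≈0 with pairShape (v zero) (v (suc zero))
  ...     | pair-x0 v₀≉0 _ =
    rank-one mono v u ∈⟨⟩-right (v₀≉0 ∘ proj₁) ∈⟨⟩-left (u₀≈0 , u₁≈0) (indep⇒nonzero indep)
  ...     | pair-xy v₁≉0 =
    rank-one mono v u ∈⟨⟩-right (v₁≉0 ∘ proj₂) ∈⟨⟩-left (u₀≈0 , u₁≈0) (indep⇒nonzero indep)
  ...     | pair-00 v₀≈0 v₁≈0 =
    ¬monochrome (tail₂ u) (tail₂ v) (tail₂-indep (u₀≈0 , u₁≈0) (v₀≈0 , v₁≈0) indep)
      (monochrome-tail₂ (u₀≈0 , u₁≈0) (v₀≈0 , v₁≈0) mono)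

  projectiveColouring : Proj.Coloring F n (palette n)
  projectiveColouring = record
    { col = λ u _ → fromℕ< (colour<palette u)
    ; wd = λ u v _ _ l l≉0 u≈lv → fromℕ<-cong _ _ (colour-scale l≉0 u≈lv) _ _
    }

  projectiveColouring-proper : Proj.Proper F n projectiveColouring
  projectiveColouring-proper u v _ indep mono = ¬monochrome u v indep monochrome
    where
    open ≡-Reasoning
    monochrome : Monochrome u v (colour u)
    monochrome w (α , β , w≈) w≢0 = begin
      colour w                          ≡⟨ colour-cong w≈ ⟩
      colour (lin α u β v)              ≡⟨ toℕ-fromℕ< _ ⟨
      toℕ (fromℕ< (colour<palette _))   ≡⟨ cong toℕ (mono α β (λ lin≈0 → w≢0 (λ i → trans (w≈ i) (lin≈0 i)))) ⟩
      toℕ (fromℕ< (colour<palette u))   ≡⟨ toℕ-fromℕ< _ ⟩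
      colour u                          ∎

χ≤palette : (F : CommutativeRing 0ℓ 0ℓ) → IsField F → HasCard F q → 3 ≤ q → ∀ n → Proj.χ≤ F n (palette n)
χ≤palette F isField card 3≤q n with FiniteRing.∃≉0,1 F 3≤q card
... | ω , ω≉0 , ω≉1 = projectiveColouring , projectiveColouring-proper
  where open Colouring F isField (FiniteRing.≈-dec F card) ω ω≉0 ω≉1

open import Data.Nat using (_+_; _*_)

theorem1p4 : ((q : ℕ) → IsPrimePower q → q ≥ 5 →
                  Σ ℕ λ C → (R : CommutativeRing 0ℓ 0ℓ) → IsField R → HasCard R q →
                    (n : ℕ) → n ≥ 1 → Σ ℕ λ m → Proj.χ≤ R n m × 2 * m ≤ n + 2 * C)
             × ((q : ℕ) → IsPrimePower q → (q ≡ 3 ⊎ q ≡ 4) →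
                  Σ ℕ λ C → (R : CommutativeRing 0ℓ 0ℓ) → IsField R → HasCard R q →
                    (n : ℕ) → n ≥ 1 → Σ ℕ λ m → Proj.χ≤ R n m × 5 * m ≤ 3 * n + 5 * C)
theorem1p4 =
    (λ q _ q≥5 → 2 , λ R isField card n _ →
      palette n , χ≤palette R isField card (≤-trans (m≤m+n 3 2) q≥5) n , 2*palette≤n+4 n)
  , (λ q _ q∈3,4 → 2 , λ R isField card n _ →
      palette n , χ≤palette R isField card (3≤q q∈3,4) n , 5*palette≤3n+10 n)
  where
  3≤q : ∀ {q} → q ≡ 3 ⊎ q ≡ 4 → 3 ≤ q
  3≤q (inj₁ ≡.refl) = ≤-refl
  3≤q (inj₂ ≡.refl) = n≤1+n 3
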